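{- Let $E$ be a finite set, $r:2^E\to\mathbb{Z}$ any function, and $m_1,m_2:2^E\to R$ ($R$ a commutative ring with $1$), with pointwise product $m_1m_2$. Let $a,b,c,d$ be indeterminates. Then $$T_{(E,r,m_1m_2)}(1-ab,1-cd)=\sum_{A\subseteq E}a^{r(E)-r(A)}d^{|A|-r(A)}\,T_{(E,r,m_1)|A}(1-a,1-c)\,T_{(E,r,m_2)/A}(1-b,1-d).$$
   Context: For a ranked set with multiplicity $\mathcal{N}=(E',r',m')$ ($E'$ finite, $r':2^{E'}\to\mathbb{Z}$, $m':2^{E'}\to R$ arbitrary), its Tutte polynomial is $T_{\mathcal{N}}(x,y)=\sum_{A\subseteq E'}m'(A)(x-1)^{r'(E')-r'(A)}(y-1)^{|A|-r'(A)}$ (a Laurent polynomial in $x-1,y-1$). For $\mathcal{M}=(E,r,m)$ and $A\subseteq E$: restriction $\mathcal{M}|A=(A,r|_{2^A},m|_{2^A})$; contraction $\mathcal{M}/A=(E\setminus A,r'',m'')$ with $r''(B)=r(B\cup A)-r(A)$, $m''(B)=m(B\cup A)$. -}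

module Defs where

open import Level using (Level)
open import Data.Nat using (ℕ; zero; suc)
open import Data.Integer using (ℤ; +_; -[1+_]) renaming (_-_ to _-ℤ_)
open import Data.Vec using ([]; _∷_)
open import Data.Fin.Subset using (Subset; inside; outside; _∪_; _─_; ∣_∣)
open import Algebra.Bundles using (CommutativeRing)
import Algebra.Properties.Ring as RingProps
open import Relation.Binary.Reasoning.Setoid as SetoidReasoning using ()

module _ {c ℓ : Level} (S : CommutativeRing c ℓ) where
  open CommutativeRing S

  pow : Carrier → ℕ → Carrier
  pow x zero    = 1#
  pow x (suc n) = x * pow x n

  record Unit : Set (c Level.⊔ ℓ) where
    constructor unit
    field
      val    : Carrier
      inv    : Carrier
      val*inv : val * inv ≈ 1#
  open Unit public

  zpow : Unit → ℤ → Carrier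
  zpow u (+ n)      = pow (val u) n
  zpow u -[1+ n ]   = pow (inv u) (suc n)

  negU : Unit → Unit
  negU (unit x x' p) = unit (- x) (- x') proof
    where
    open RingProps ring
    open SetoidReasoning setoid
    proof : (- x) * (- x') ≈ 1#
    proof = begin
      (- x) * (- x')   ≈⟨ sym (-‿distribˡ-* x (- x')) ⟩
      - (x * (- x'))   ≈⟨ -‿cong (sym (-‿distribʳ-* x x')) ⟩
      - (- (x * x'))   ≈⟨ -‿involutive (x * x') ⟩
      x * x'           ≈⟨ p ⟩
      1#               ∎

  mulU : Unit → Unit → Unit
  mulU (unit x x' p) (unit y y' q) = unit (x * y) (x' * y') proof
    where
    open SetoidReasoning setoid
    proof : (x * y) * (x' * y') ≈ 1#
    proof = begin
      (x * y) * (x' * y')   ≈⟨ *-assoc x y (x' * y') ⟩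
      x * (y * (x' * y'))   ≈⟨ *-congˡ (sym (*-assoc y x' y')) ⟩
      x * ((y * x') * y')   ≈⟨ *-congˡ (*-congʳ (*-comm y x')) ⟩
      x * ((x' * y) * y')   ≈⟨ *-congˡ (*-assoc x' y y') ⟩
      x * (x' * (y * y'))   ≈⟨ *-congˡ (*-congˡ q) ⟩
      x * (x' * 1#)         ≈⟨ *-congˡ (*-identityʳ x') ⟩
      x * x'                ≈⟨ p ⟩
      1#                    ∎

  sumSub : ∀ {n} → Subset n → (Subset n → Carrier) → Carrier
  sumSub []            f = f []
  sumSub (outside ∷ X) f = sumSub X (λ B → f (outside ∷ B))
  sumSub (inside ∷ X)  f = sumSub X (λ B → f (outside ∷ B)) + sumSub X (λ B → f (inside ∷ B))

  -- A ranked set with multiplicity (E', r', m') whose finite ground set E' is a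
  -- subset of an ambient Fin n; r' and m' are only ever evaluated on subsets of E'.
  record RankedSet (n : ℕ) : Set c where
    constructor ⟨_,_,_⟩
    field
      ground : Subset n
      rk     : Subset n → ℤ
      mult   : Subset n → Carrier
  open RankedSet public

  -- Tutte polynomial T_N(x,y) evaluated at x - 1 = u, y - 1 = v (u, v units):
  --   Σ_{A ⊆ E'} m'(A) u^{r'(E') - r'(A)} v^{|A| - r'(A)}
  tutte : ∀ {n} → RankedSet n → (u v : Unit) → Carrier
  tutte N u v = sumSub (ground N) (λ A →
      mult N A * zpow u (rk N (ground N) -ℤ rk N A) * zpow v ((+ ∣ A ∣) -ℤ rk N A))

  restrict : ∀ {n} → RankedSet n → Subset n → RankedSet n
  restrict N A = ⟨ A , rk N , mult N ⟩

  contract : ∀ {n} → RankedSet n → Subset n → RankedSet n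
  contract N A = ⟨ ground N ─ A , (λ B → rk N (B ∪ A) -ℤ rk N A) , (λ B → mult N (B ∪ A)) ⟩

module Submission where

-- Expanding both Tutte polynomials on the right turns it into a triple sum over
-- B ⊆ A ⊆ E and C ⊆ E ∖ A.  After collecting powers, a summand depends on (A , C)
-- only through X = A ∪ C and a sign (-1)^{|C|}; so moving one element from A into C
-- flips its sign.  A sign-reversing cancellation (the lemma 'collapse') shows the
-- triple sum equals its diagonal part A = B = X, C = ∅, which is exactly the
-- summand of the left-hand side.

open import Level using (Level)
open import Data.Nat as ℕ using (ℕ; zero; suc)
import Data.Nat.Properties as ℕ
open import Data.Integer as ℤ using (ℤ; +_; -[1+_]; _⊖_)
  renaming (_-_ to _-ℤ_; _+_ to _+ℤ_; -_ to -ℤ_)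
import Data.Integer.Properties as ℤ
open import Data.Integer.Tactic.RingSolver using (solve-∀)
open import Data.Vec using ([]; _∷_)
open import Data.Fin.Subset using (Subset; ⊤; ⊥; ∣_∣; inside; outside; _∪_; _─_)
open import Data.Fin.Subset.Properties using (∣⊥∣≡0; ∪-identityˡ)
open import Algebra.Bundles using (CommutativeRing)
open import Algebra.Morphism.Structures using (module RingMorphisms)
import Algebra.Properties.Ring as RingProperties
import Algebra.Properties.CommutativeSemiring.Exp as ExpProperties
import Algebra.Solver.CommutativeMonoid as CommutativeMonoidSolver
open import Relation.Binary.PropositionalEquality as ≡ using (_≡_)
import Relation.Binary.Reasoning.Setoid as SetoidReasoning

open import Defs

-- (A′ , C′) arises from (A , C) by moving one element that lies in A but not in C
-- from A into C.  This is the move of the sign-reversing cancellation.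
data MoveOne : ∀ {n} → Subset n → Subset n → Subset n → Subset n → Set where
  here  : ∀ {n} {A C : Subset n} →
          MoveOne (inside ∷ A) (outside ∷ C) (outside ∷ A) (inside ∷ C)
  there : ∀ {n x y} {A C A′ C′ : Subset n} →
          MoveOne A C A′ C′ → MoveOne (x ∷ A) (y ∷ C) (x ∷ A′) (y ∷ C′)

moveOne-∪ : ∀ {n} {A C A′ C′ : Subset n} → MoveOne A C A′ C′ → C ∪ A ≡ C′ ∪ A′
moveOne-∪ here      = ≡.refl
moveOne-∪ (there s) = ≡.cong (_ ∷_) (moveOne-∪ s)

moveOne-∣A∣ : ∀ {n} {A C A′ C′ : Subset n} → MoveOne A C A′ C′ → ∣ A ∣ ≡ suc ∣ A′ ∣
moveOne-∣A∣ here                    = ≡.refl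
moveOne-∣A∣ (there {x = inside} s)  = ≡.cong suc (moveOne-∣A∣ s)
moveOne-∣A∣ (there {x = outside} s) = moveOne-∣A∣ s

moveOne-∣C∣ : ∀ {n} {A C A′ C′ : Subset n} → MoveOne A C A′ C′ → ∣ C′ ∣ ≡ suc ∣ C ∣
moveOne-∣C∣ here                    = ≡.refl
moveOne-∣C∣ (there {y = inside} s)  = ≡.cong suc (moveOne-∣C∣ s)
moveOne-∣C∣ (there {y = outside} s) = moveOne-∣C∣ s

moveOne-size : ∀ {n} {A C A′ C′ : Subset n} → MoveOne A C A′ C′ →
               ∣ A ∣ ℕ.+ ∣ C ∣ ≡ ∣ A′ ∣ ℕ.+ ∣ C′ ∣
moveOne-size {A = A} {C = C} {A′ = A′} {C′ = C′} s = begin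
  ∣ A ∣ ℕ.+ ∣ C ∣       ≡⟨ ≡.cong (ℕ._+ ∣ C ∣) (moveOne-∣A∣ s) ⟩
  suc ∣ A′ ∣ ℕ.+ ∣ C ∣  ≡⟨ ≡.sym (ℕ.+-suc ∣ A′ ∣ ∣ C ∣) ⟩
  ∣ A′ ∣ ℕ.+ suc ∣ C ∣  ≡⟨ ≡.cong (∣ A′ ∣ ℕ.+_) (≡.sym (moveOne-∣C∣ s)) ⟩
  ∣ A′ ∣ ℕ.+ ∣ C′ ∣     ∎
  where open ≡.≡-Reasoning

complement-∪ : ∀ {n} (A : Subset n) → (⊤ ─ A) ∪ A ≡ ⊤
complement-∪ []            = ≡.refl
complement-∪ (inside ∷ A)  = ≡.cong (inside ∷_) (complement-∪ A)
complement-∪ (outside ∷ A) = ≡.cong (inside ∷_) (complement-∪ A)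

-- Identities between the exponents of a summand, writing α = r(A), β = r(B),
-- χ = r(A ∪ C) and e = r(E).

-- The b-exponent of the contraction is the corank of A ∪ C.
contraction-corank : ∀ e α χ → (e -ℤ α) -ℤ (χ -ℤ α) ≡ e -ℤ χ
contraction-corank = solve-∀

corank-telescope : ∀ e α β → (e -ℤ α) +ℤ (α -ℤ β) ≡ e -ℤ β
corank-telescope = solve-∀

nullity-telescope : ∀ p q α χ → (p -ℤ α) +ℤ (q -ℤ (χ -ℤ α)) ≡ (p +ℤ q) -ℤ χ
nullity-telescope = solve-∀

-- The four sign exponents of a summand add up to |C| + (|B| + e) up to an even number.
sign-exponent : ∀ e α β χ nB nC →
  (((α -ℤ β) +ℤ (nB -ℤ β)) +ℤ (e -ℤ χ)) +ℤ (nC -ℤ (χ -ℤ α))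
  ≡ (nC +ℤ (nB +ℤ e)) +ℤ ((α -ℤ (β +ℤ χ)) +ℤ (α -ℤ (β +ℤ χ)))
sign-exponent = solve-∀

-- The two sign exponents of a left-hand summand add up to |X| + e up to an even number.
diagonal-sign-exponent : ∀ e χ nX →
  (e -ℤ χ) +ℤ (nX -ℤ χ) ≡ (nX +ℤ e) +ℤ ((-ℤ χ) +ℤ (-ℤ χ))
diagonal-sign-exponent = solve-∀

module SubsetSums {c ℓ : Level} (S : CommutativeRing c ℓ) where
  open CommutativeRing S
  open SetoidReasoning setoid
  open CommutativeMonoidSolver +-commutativeMonoid using (solve; _⊜_; _⊕_)

  ∑ : ∀ {n} → Subset n → (Subset n → Carrier) → Carrier
  ∑ = sumSub S

  sumSub-cong : ∀ {n} (X : Subset n) {f g : Subset n → Carrier} →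
                (∀ B → f B ≈ g B) → ∑ X f ≈ ∑ X g
  sumSub-cong []            p = p []
  sumSub-cong (outside ∷ X) p = sumSub-cong X (λ B → p (outside ∷ B))
  sumSub-cong (inside ∷ X)  p =
    +-cong (sumSub-cong X (λ B → p (outside ∷ B))) (sumSub-cong X (λ B → p (inside ∷ B)))

  sumSub-+ : ∀ {n} (X : Subset n) (f g : Subset n → Carrier) →
             ∑ X (λ B → f B + g B) ≈ ∑ X f + ∑ X g
  sumSub-+ []            f g = refl
  sumSub-+ (outside ∷ X) f g = sumSub-+ X _ _
  sumSub-+ (inside ∷ X)  f g = trans (+-cong (sumSub-+ X _ _) (sumSub-+ X _ _)) (interchange _ _ _ _)
    where
    interchange : ∀ w x y z → (w + x) + (y + z) ≈ (w + y) + (x + z)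
    interchange = solve 4 (λ w x y z → (w ⊕ x) ⊕ (y ⊕ z) ⊜ (w ⊕ y) ⊕ (x ⊕ z)) refl

  sumSub-zero : ∀ {n} (X : Subset n) (f : Subset n → Carrier) → (∀ B → f B ≈ 0#) → ∑ X f ≈ 0#
  sumSub-zero []            f p = p []
  sumSub-zero (outside ∷ X) f p = sumSub-zero X _ (λ B → p _)
  sumSub-zero (inside ∷ X)  f p =
    trans (+-cong (sumSub-zero X _ (λ B → p _)) (sumSub-zero X _ (λ B → p _))) (+-identityˡ 0#)

  sumSub-*ˡ : ∀ {n} (X : Subset n) (x : Carrier) (f : Subset n → Carrier) →
              x * ∑ X f ≈ ∑ X (λ B → x * f B)
  sumSub-*ˡ []            x f = refl
  sumSub-*ˡ (outside ∷ X) x f = sumSub-*ˡ X x _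
  sumSub-*ˡ (inside ∷ X)  x f = trans (distribˡ x _ _) (+-cong (sumSub-*ˡ X x _) (sumSub-*ˡ X x _))

  sumSub-*ʳ : ∀ {n} (X : Subset n) (x : Carrier) (f : Subset n → Carrier) →
              ∑ X f * x ≈ ∑ X (λ B → f B * x)
  sumSub-*ʳ []            x f = refl
  sumSub-*ʳ (outside ∷ X) x f = sumSub-*ʳ X x _
  sumSub-*ʳ (inside ∷ X)  x f = trans (distribʳ x _ _) (+-cong (sumSub-*ʳ X x _) (sumSub-*ʳ X x _))

  -- Σ_{A ⊆ Y} Σ_{B ⊆ A} Σ_{C ⊆ Y ∖ A} F A B C, the shape of the expanded right-hand side.
  nestedSum : ∀ {n} → Subset n → (Subset n → Subset n → Subset n → Carrier) → Carrier
  nestedSum Y F = ∑ Y (λ A → ∑ A (λ B → ∑ (Y ─ A) (λ C → F A B C)))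

  nestedSum-+ : ∀ {n} (Y : Subset n) (F G : Subset n → Subset n → Subset n → Carrier) →
    nestedSum Y (λ A B C → F A B C + G A B C) ≈ nestedSum Y F + nestedSum Y G
  nestedSum-+ Y F G = begin
    nestedSum Y (λ A B C → F A B C + G A B C)
      ≈⟨ sumSub-cong Y (λ A → sumSub-cong A (λ B → sumSub-+ (Y ─ A) _ _)) ⟩
    ∑ Y (λ A → ∑ A (λ B → ∑ (Y ─ A) (F A B) + ∑ (Y ─ A) (G A B)))
      ≈⟨ sumSub-cong Y (λ A → sumSub-+ A _ _) ⟩
    ∑ Y (λ A → ∑ A (λ B → ∑ (Y ─ A) (F A B)) + ∑ A (λ B → ∑ (Y ─ A) (G A B)))
      ≈⟨ sumSub-+ Y _ _ ⟩
    nestedSum Y F + nestedSum Y G ∎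

  nestedSum-zero : ∀ {n} (Y : Subset n) (F : Subset n → Subset n → Subset n → Carrier) →
                   (∀ A B C → F A B C ≈ 0#) → nestedSum Y F ≈ 0#
  nestedSum-zero Y F p =
    sumSub-zero Y _ (λ A → sumSub-zero A _ (λ B → sumSub-zero (Y ─ A) _ (p A B)))

  -- On a new element of Y the terms split into four classes (element in none of
  -- A, B, C / only in C / only in A / in A and B); the middle two cancel against
  -- each other by the move at this element, the outer two are handled by induction.
  collapse : ∀ {n} (Y : Subset n) (F : Subset n → Subset n → Subset n → Carrier) →
    (∀ {A B C A′ C′} → MoveOne A C A′ C′ → F A B C ≈ - F A′ B C′) →
    nestedSum Y F ≈ ∑ Y (λ X → F X X ⊥)
  collapse []            F anti = refl
  collapse (outside ∷ Y) F anti =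
    collapse Y (λ A B C → F (outside ∷ A) (outside ∷ B) (outside ∷ C)) (λ s → anti (there s))
  collapse (inside ∷ Y)  F anti = begin
    nestedSum (inside ∷ Y) F
      ≈⟨ +-cong (trans (sumSub-cong Y (λ A → sumSub-+ A _ _)) (sumSub-+ Y _ _)) (sumSub-+ Y _ _) ⟩
    (nestedSum Y None + nestedSum Y OnlyC) + (nestedSum Y OnlyA + nestedSum Y InAB)
      ≈⟨ regroup _ _ _ _ ⟩
    (nestedSum Y None + nestedSum Y InAB) + (nestedSum Y OnlyA + nestedSum Y OnlyC)
      ≈⟨ +-congˡ cancel ⟩
    (nestedSum Y None + nestedSum Y InAB) + 0#
      ≈⟨ +-identityʳ _ ⟩
    nestedSum Y None + nestedSum Y InAB
      ≈⟨ +-cong (collapse Y None (λ s → anti (there s))) (collapse Y InAB (λ s → anti (there s))) ⟩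
    ∑ (inside ∷ Y) (λ X → F X X ⊥) ∎
    where
    None OnlyC OnlyA InAB : Subset _ → Subset _ → Subset _ → Carrier
    None  A B C = F (outside ∷ A) (outside ∷ B) (outside ∷ C)
    OnlyC A B C = F (outside ∷ A) (outside ∷ B) (inside ∷ C)
    OnlyA A B C = F (inside ∷ A) (outside ∷ B) (outside ∷ C)
    InAB  A B C = F (inside ∷ A) (inside ∷ B) (outside ∷ C)

    regroup : ∀ w x y z → (w + x) + (y + z) ≈ (w + z) + (y + x)
    regroup = solve 4 (λ w x y z → (w ⊕ x) ⊕ (y ⊕ z) ⊜ (w ⊕ z) ⊕ (y ⊕ x)) refl

    cancel : nestedSum Y OnlyA + nestedSum Y OnlyC ≈ 0#
    cancel = trans (sym (nestedSum-+ Y OnlyA OnlyC))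
                   (nestedSum-zero Y _ (λ A B C → trans (+-congʳ (anti here)) (-‿inverseˡ _)))

module Powers {c ℓ : Level} (S : CommutativeRing c ℓ) where
  open CommutativeRing S
  open RingProperties ring using (-1*x≈-x; -‿involutive)
  open ExpProperties commutativeSemiring using (_^_; ^-congˡ; ^-homo-*; ^-distrib-*)
  open SetoidReasoning setoid
  open CommutativeMonoidSolver *-commutativeMonoid using (solve; _⊜_; _⊕_)

  pow≡^ : ∀ x n → pow S x n ≡ x ^ n
  pow≡^ x zero    = ≡.refl
  pow≡^ x (suc n) = ≡.cong (x *_) (pow≡^ x n)

  pow-cong : ∀ {x y} n → x ≈ y → pow S x n ≈ pow S y n
  pow-cong {x} {y} n p rewrite pow≡^ x n | pow≡^ y n = ^-congˡ n p

  pow-+ : ∀ x m n → pow S x (m ℕ.+ n) ≈ pow S x m * pow S x n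
  pow-+ x m n rewrite pow≡^ x (m ℕ.+ n) | pow≡^ x m | pow≡^ x n = ^-homo-* x m n

  pow-* : ∀ x y n → pow S (x * y) n ≈ pow S x n * pow S y n
  pow-* x y n rewrite pow≡^ (x * y) n | pow≡^ x n | pow≡^ y n = ^-distrib-* x y n

  pow-1# : ∀ n → pow S 1# n ≈ 1#
  pow-1# zero    = refl
  pow-1# (suc n) = trans (*-identityˡ _) (pow-1# n)

  -- u^{m ⊖ n} = u^m (u⁻¹)^n, proved by cancelling u u⁻¹ = 1 while both m, n > 0.
  zpow-⊖ : (u : Unit S) → ∀ m n → zpow S u (m ⊖ n) ≈ pow S (val u) m * pow S (inv u) n
  zpow-⊖ u zero    zero    = sym (*-identityˡ _)
  zpow-⊖ u (suc m) zero    = sym (*-identityʳ _)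
  zpow-⊖ u zero    (suc n) = sym (*-identityˡ _)
  zpow-⊖ u (suc m) (suc n) = begin
    zpow S u (suc m ⊖ suc n)    ≡⟨ ≡.cong (zpow S u) (ℤ.[1+m]⊖[1+n]≡m⊖n m n) ⟩
    zpow S u (m ⊖ n)            ≈⟨ zpow-⊖ u m n ⟩
    xᵐ * x′ⁿ                    ≈⟨ sym (*-identityˡ _) ⟩
    1# * (xᵐ * x′ⁿ)             ≈⟨ *-congʳ (sym (val*inv u)) ⟩
    (x * x′) * (xᵐ * x′ⁿ)       ≈⟨ interchange x x′ xᵐ x′ⁿ ⟩
    (x * xᵐ) * (x′ * x′ⁿ)       ∎
    where
    x = val u
    x′ = inv u
    xᵐ = pow S x m
    x′ⁿ = pow S x′ n
    interchange : ∀ w x y z → (w * x) * (y * z) ≈ (w * y) * (x * z)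
    interchange = solve 4 (λ w x y z → (w ⊕ x) ⊕ (y ⊕ z) ⊜ (w ⊕ y) ⊕ (x ⊕ z)) refl

  zpow-+ : (u : Unit S) → ∀ i j → zpow S u (i +ℤ j) ≈ zpow S u i * zpow S u j
  zpow-+ u (+ m)    (+ n)    = pow-+ _ m n
  zpow-+ u (+ m)    -[1+ n ] = zpow-⊖ u m (suc n)
  zpow-+ u -[1+ m ] (+ n)    = trans (zpow-⊖ u n (suc m)) (*-comm _ _)
  zpow-+ u -[1+ m ] -[1+ n ] = begin
    pow S x′ (suc (suc (m ℕ.+ n)))       ≡⟨ ≡.cong (λ k → pow S x′ (suc k)) (≡.sym (ℕ.+-suc m n)) ⟩
    pow S x′ (suc m ℕ.+ suc n)           ≈⟨ pow-+ x′ (suc m) (suc n) ⟩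
    pow S x′ (suc m) * pow S x′ (suc n)  ∎
    where x′ = inv u

  zpow-mulU : (u v : Unit S) → ∀ k → zpow S (mulU S u v) k ≈ zpow S u k * zpow S v k
  zpow-mulU u v (+ n)    = pow-* _ _ n
  zpow-mulU u v -[1+ n ] = pow-* _ _ (suc n)

  minusOne : Unit S
  minusOne = negU S (unit 1# 1# (*-identityˡ 1#))

  sign : ℤ → Carrier
  sign = zpow S minusOne

  sign-+ : ∀ i j → sign (i +ℤ j) ≈ sign i * sign j
  sign-+ = zpow-+ minusOne

  zpow-negU : (u : Unit S) → ∀ k → zpow S (negU S u) k ≈ sign k * zpow S u k
  zpow-negU u (+ n)    = trans (pow-cong n (sym (-1*x≈-x _))) (pow-* _ _ n)
  zpow-negU u -[1+ n ] = trans (pow-cong (suc n) (sym (-1*x≈-x _))) (pow-* _ _ (suc n))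

  -- One more factor -1 negates the sign; this is what the move of one element does.
  sign-suc : ∀ n → sign (+ suc n) ≈ - sign (+ n)
  sign-suc n = -1*x≈-x _

  minusOne-square : ∀ n → pow S (- 1#) n * pow S (- 1#) n ≈ 1#
  minusOne-square n = begin
    pow S (- 1#) n * pow S (- 1#) n  ≈⟨ sym (pow-* _ _ n) ⟩
    pow S ((- 1#) * (- 1#)) n        ≈⟨ pow-cong n (trans (-1*x≈-x _) (-‿involutive 1#)) ⟩
    pow S 1# n                       ≈⟨ pow-1# n ⟩
    1#                               ∎

  sign-square : ∀ k → sign k * sign k ≈ 1#
  sign-square (+ n)    = minusOne-square n
  sign-square -[1+ n ] = minusOne-square (suc n)

  sign-even : ∀ k j → sign (k +ℤ (j +ℤ j)) ≈ sign k
  sign-even k j = begin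
    sign (k +ℤ (j +ℤ j))       ≈⟨ sign-+ k (j +ℤ j) ⟩
    sign k * sign (j +ℤ j)     ≈⟨ *-congˡ (sign-+ j j) ⟩
    sign k * (sign j * sign j) ≈⟨ *-congˡ (sign-square j) ⟩
    sign k * 1#                ≈⟨ *-identityʳ _ ⟩
    sign k                     ∎

module Convolution {c ℓ : Level} (S : CommutativeRing c ℓ) (a b c d : Unit S) {n : ℕ}
  (r : Subset n → ℤ) (M₁ M₂ : Subset n → CommutativeRing.Carrier S) where
  open CommutativeRing S
  open RingProperties ring using (-‿distribˡ-*; -‿involutive)
  open SetoidReasoning setoid
  open CommutativeMonoidSolver *-commutativeMonoid using (solve; _⊜_; _⊕_)
  open SubsetSums S
  open Powers S

  private
    e : ℤ
    e = r ⊤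

    corank nullity : Subset n → ℤ
    corank A = e -ℤ r A
    nullity A = (+ ∣ A ∣) -ℤ r A

  -- The three factors of the right-hand side summand for A, and the summands of
  -- the two Tutte polynomials (of the restriction to A and of the contraction by A).
  weight : Subset n → Carrier
  weight A = zpow S a (corank A) * zpow S d (nullity A)

  restrictionTerm : Subset n → Subset n → Carrier
  restrictionTerm A B = M₁ B * zpow S (negU S a) (r A -ℤ r B) * zpow S (negU S c) (nullity B)

  contractionTerm : Subset n → Subset n → Carrier
  contractionTerm A C = M₂ (C ∪ A)
    * zpow S (negU S b) ((r ((⊤ ─ A) ∪ A) -ℤ r A) -ℤ (r (C ∪ A) -ℤ r A))
    * zpow S (negU S d) ((+ ∣ C ∣) -ℤ (r (C ∪ A) -ℤ r A))

  term : Subset n → Subset n → Subset n → Carrier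
  term A B C = (weight A * restrictionTerm A B) * contractionTerm A C

  -- What remains of a summand after collecting powers, for X = A ∪ C and N = |A| + |C|.
  core : Subset n → Subset n → ℤ → Carrier
  core B X N = sign ((+ ∣ B ∣) +ℤ e) * ((M₁ B * M₂ X)
    * (((zpow S a (corank B) * zpow S c (nullity B)) * zpow S b (corank X)) * zpow S d (N -ℤ r X)))

  term-normalForm : ∀ A B C →
    term A B C ≈ sign (+ ∣ C ∣) * core B (C ∪ A) ((+ ∣ A ∣) +ℤ (+ ∣ C ∣))
  term-normalForm A B C = begin
    term A B C
      ≈⟨ *-cong (*-congˡ (*-cong (*-congˡ (zpow-negU a (α -ℤ β))) (zpow-negU c nB-β)))
                (*-cong (*-congˡ (trans (reflexive (≡.cong (zpow S (negU S b)) bExp)) (zpow-negU b (e -ℤ χ))))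
                        (zpow-negU d nC-χα)) ⟩
    ((a₁ * d₁) * ((m₁ * (s₁ * a₂)) * (s₂ * c₂))) * ((m₂ * (s₃ * b₃)) * (s₄ * d₄))
      ≈⟨ rearrange a₁ d₁ m₁ s₁ a₂ s₂ c₂ m₂ s₃ b₃ s₄ d₄ ⟩
    (((s₁ * s₂) * s₃) * s₄) * ((m₁ * m₂) * ((((a₁ * a₂) * c₂) * b₃) * (d₁ * d₄)))
      ≈⟨ *-cong signs (*-congˡ (*-cong (*-congʳ (*-congʳ aa)) dd)) ⟩
    (sign nC * sign (nB +ℤ e)) * ((m₁ * m₂) * (((zpow S a (e -ℤ β) * c₂) * b₃) * zpow S d ((nA +ℤ nC) -ℤ χ)))
      ≈⟨ *-assoc _ _ _ ⟩
    sign nC * core B (C ∪ A) (nA +ℤ nC) ∎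
    where
    α = r A
    β = r B
    χ = r (C ∪ A)
    nA = + ∣ A ∣
    nB = + ∣ B ∣
    nC = + ∣ C ∣
    nB-β = nB -ℤ β
    nC-χα = nC -ℤ (χ -ℤ α)
    bExp : (r ((⊤ ─ A) ∪ A) -ℤ α) -ℤ (χ -ℤ α) ≡ e -ℤ χ
    bExp = ≡.trans (≡.cong (λ Z → (r Z -ℤ α) -ℤ (χ -ℤ α)) (complement-∪ A)) (contraction-corank e α χ)
    a₁ = zpow S a (e -ℤ α)
    d₁ = zpow S d (nA -ℤ α)
    m₁ = M₁ B
    s₁ = sign (α -ℤ β)
    a₂ = zpow S a (α -ℤ β)
    s₂ = sign nB-β
    c₂ = zpow S c nB-β
    m₂ = M₂ (C ∪ A)
    s₃ = sign (e -ℤ χ)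
    b₃ = zpow S b (e -ℤ χ)
    s₄ = sign nC-χα
    d₄ = zpow S d nC-χα
    rearrange : ∀ a₁ d₁ m₁ s₁ a₂ s₂ c₂ m₂ s₃ b₃ s₄ d₄ →
      ((a₁ * d₁) * ((m₁ * (s₁ * a₂)) * (s₂ * c₂))) * ((m₂ * (s₃ * b₃)) * (s₄ * d₄))
      ≈ (((s₁ * s₂) * s₃) * s₄) * ((m₁ * m₂) * ((((a₁ * a₂) * c₂) * b₃) * (d₁ * d₄)))
    rearrange = solve 12 (λ a₁ d₁ m₁ s₁ a₂ s₂ c₂ m₂ s₃ b₃ s₄ d₄ →
      ((a₁ ⊕ d₁) ⊕ ((m₁ ⊕ (s₁ ⊕ a₂)) ⊕ (s₂ ⊕ c₂))) ⊕ ((m₂ ⊕ (s₃ ⊕ b₃)) ⊕ (s₄ ⊕ d₄))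
      ⊜ (((s₁ ⊕ s₂) ⊕ s₃) ⊕ s₄) ⊕ ((m₁ ⊕ m₂) ⊕ ((((a₁ ⊕ a₂) ⊕ c₂) ⊕ b₃) ⊕ (d₁ ⊕ d₄)))) refl
    signs : ((s₁ * s₂) * s₃) * s₄ ≈ sign nC * sign (nB +ℤ e)
    signs = begin
      ((s₁ * s₂) * s₃) * s₄
        ≈⟨ *-congʳ (*-congʳ (sym (sign-+ (α -ℤ β) nB-β))) ⟩
      (sign k₁₂ * s₃) * s₄
        ≈⟨ *-congʳ (sym (sign-+ k₁₂ (e -ℤ χ))) ⟩
      sign k₁₂₃ * s₄
        ≈⟨ sym (sign-+ k₁₂₃ nC-χα) ⟩
      sign (k₁₂₃ +ℤ nC-χα)
        ≡⟨ ≡.cong sign (sign-exponent e α β χ nB nC) ⟩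
      sign ((nC +ℤ (nB +ℤ e)) +ℤ (j +ℤ j))
        ≈⟨ sign-even (nC +ℤ (nB +ℤ e)) j ⟩
      sign (nC +ℤ (nB +ℤ e))
        ≈⟨ sign-+ nC (nB +ℤ e) ⟩
      sign nC * sign (nB +ℤ e) ∎
      where
      k₁₂ = (α -ℤ β) +ℤ nB-β
      k₁₂₃ = k₁₂ +ℤ (e -ℤ χ)
      j = α -ℤ (β +ℤ χ)
    aa : a₁ * a₂ ≈ zpow S a (e -ℤ β)
    aa = trans (sym (zpow-+ a (e -ℤ α) (α -ℤ β))) (reflexive (≡.cong (zpow S a) (corank-telescope e α β)))
    dd : d₁ * d₄ ≈ zpow S d ((nA +ℤ nC) -ℤ χ)
    dd = trans (sym (zpow-+ d (nA -ℤ α) nC-χα)) (reflexive (≡.cong (zpow S d) (nullity-telescope nA nC α χ)))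

  -- Moving one element from A into C negates the summand: the normal form only sees
  -- A ∪ C and |A| + |C|, which are preserved, and the sign (-1)^{|C|}, which flips.
  term-antisymmetric : ∀ {A B C A′ C′} → MoveOne A C A′ C′ → term A B C ≈ - term A′ B C′
  term-antisymmetric {A} {B} {C} {A′} {C′} s = begin
    term A B C                                  ≈⟨ term-normalForm A B C ⟩
    sign (+ ∣ C ∣) * K                          ≈⟨ sym (-‿involutive _) ⟩
    - (- (sign (+ ∣ C ∣) * K))                  ≈⟨ -‿cong (-‿distribˡ-* _ _) ⟩
    - (- sign (+ ∣ C ∣) * K)                    ≈⟨ -‿cong (*-congʳ (sym (sign-suc ∣ C ∣))) ⟩
    - (sign (+ suc ∣ C ∣) * K)                  ≡⟨ ≡.cong₂ (λ k Z → - (sign (+ k) * Z)) (≡.sym (moveOne-∣C∣ s)) sameCore ⟩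
    - (sign (+ ∣ C′ ∣) * core B (C′ ∪ A′) ((+ ∣ A′ ∣) +ℤ (+ ∣ C′ ∣)))
                                                ≈⟨ -‿cong (sym (term-normalForm A′ B C′)) ⟩
    - term A′ B C′                              ∎
    where
    K = core B (C ∪ A) ((+ ∣ A ∣) +ℤ (+ ∣ C ∣))
    sameCore : K ≡ core B (C′ ∪ A′) ((+ ∣ A′ ∣) +ℤ (+ ∣ C′ ∣))
    sameCore = ≡.cong₂ (core B) (moveOne-∪ s) (≡.cong +_ (moveOne-size s))

  term-diagonal : ∀ X → term X X ⊥ ≈
    (M₁ X * M₂ X) * zpow S (negU S (mulU S a b)) (corank X) * zpow S (negU S (mulU S c d)) (nullity X)
  term-diagonal X = begin
    term X X ⊥
      ≈⟨ term-normalForm X X ⊥ ⟩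
    sign (+ ∣ ⊥ {n} ∣) * core X (⊥ ∪ X) ((+ ∣ X ∣) +ℤ (+ ∣ ⊥ {n} ∣))
      ≡⟨ ≡.cong₂ (λ k Z → sign (+ k) * Z) (∣⊥∣≡0 n)
           (≡.cong₂ (core X) (∪-identityˡ X) (≡.cong (λ k → + (∣ X ∣ ℕ.+ k)) (∣⊥∣≡0 n))) ⟩
    1# * core X X (+ (∣ X ∣ ℕ.+ 0))
      ≡⟨ ≡.cong (λ k → 1# * core X X (+ k)) (ℕ.+-identityʳ ∣ X ∣) ⟩
    1# * core X X (+ ∣ X ∣)
      ≈⟨ *-identityˡ _ ⟩
    sign (+ ∣ X ∣ +ℤ e) * (m * (((aE * cN) * bE) * dN))
      ≈⟨ *-congʳ signs ⟩
    (sE * sN) * (m * (((aE * cN) * bE) * dN))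
      ≈⟨ rearrange m sE aE bE sN cN dN ⟩
    (m * (sE * (aE * bE))) * (sN * (cN * dN))
      ≈⟨ sym (*-cong (*-congˡ (trans (zpow-negU (mulU S a b) (corank X)) (*-congˡ (zpow-mulU a b (corank X)))))
                      (trans (zpow-negU (mulU S c d) (nullity X)) (*-congˡ (zpow-mulU c d (nullity X))))) ⟩
    m * zpow S (negU S (mulU S a b)) (corank X) * zpow S (negU S (mulU S c d)) (nullity X) ∎
    where
    m = M₁ X * M₂ X
    sE = sign (corank X)
    aE = zpow S a (corank X)
    bE = zpow S b (corank X)
    sN = sign (nullity X)
    cN = zpow S c (nullity X)
    dN = zpow S d (nullity X)
    signs : sign (+ ∣ X ∣ +ℤ e) ≈ sE * sN
    signs = begin
      sign (+ ∣ X ∣ +ℤ e)                                  ≈⟨ sym (sign-even (+ ∣ X ∣ +ℤ e) (-ℤ r X)) ⟩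
      sign ((+ ∣ X ∣ +ℤ e) +ℤ ((-ℤ r X) +ℤ (-ℤ r X)))      ≡⟨ ≡.cong sign (≡.sym (diagonal-sign-exponent e (r X) (+ ∣ X ∣))) ⟩
      sign (corank X +ℤ nullity X)                         ≈⟨ sign-+ (corank X) (nullity X) ⟩
      sE * sN                                              ∎
    rearrange : ∀ m sE aE bE sN cN dN →
      (sE * sN) * (m * (((aE * cN) * bE) * dN)) ≈ (m * (sE * (aE * bE))) * (sN * (cN * dN))
    rearrange = solve 7 (λ m sE aE bE sN cN dN →
      (sE ⊕ sN) ⊕ (m ⊕ (((aE ⊕ cN) ⊕ bE) ⊕ dN)) ⊜ (m ⊕ (sE ⊕ (aE ⊕ bE))) ⊕ (sN ⊕ (cN ⊕ dN))) refl

  expand : ∀ A → (weight A * ∑ A (restrictionTerm A)) * ∑ (⊤ ─ A) (contractionTerm A)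
                 ≈ ∑ A (λ B → ∑ (⊤ ─ A) (λ C → term A B C))
  expand A = begin
    (weight A * ∑ A (restrictionTerm A)) * ∑ (⊤ ─ A) (contractionTerm A)
      ≈⟨ *-congʳ (sumSub-*ˡ A (weight A) (restrictionTerm A)) ⟩
    ∑ A (λ B → weight A * restrictionTerm A B) * ∑ (⊤ ─ A) (contractionTerm A)
      ≈⟨ sumSub-*ʳ A _ _ ⟩
    ∑ A (λ B → (weight A * restrictionTerm A B) * ∑ (⊤ ─ A) (contractionTerm A))
      ≈⟨ sumSub-cong A (λ B → sumSub-*ˡ (⊤ ─ A) _ (contractionTerm A)) ⟩
    ∑ A (λ B → ∑ (⊤ ─ A) (λ C → term A B C)) ∎

  convolution : (M₁₂ : Subset n → Carrier) → (∀ X → M₁₂ X ≈ M₁ X * M₂ X) →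
    tutte S ⟨ ⊤ , r , M₁₂ ⟩ (negU S (mulU S a b)) (negU S (mulU S c d))
    ≈ ∑ ⊤ (λ A → (weight A * tutte S (restrict S ⟨ ⊤ , r , M₁ ⟩ A) (negU S a) (negU S c))
                  * tutte S (contract S ⟨ ⊤ , r , M₂ ⟩ A) (negU S b) (negU S d))
  convolution M₁₂ M₁₂≈M₁M₂ = sym (begin
    ∑ ⊤ (λ A → (weight A * ∑ A (restrictionTerm A)) * ∑ (⊤ ─ A) (contractionTerm A))
      ≈⟨ sumSub-cong ⊤ expand ⟩
    nestedSum ⊤ term
      ≈⟨ collapse ⊤ term term-antisymmetric ⟩
    ∑ ⊤ (λ X → term X X ⊥)
      ≈⟨ sumSub-cong ⊤ (λ X → trans (term-diagonal X) (*-congʳ (*-congʳ (sym (M₁₂≈M₁M₂ X))))) ⟩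
    tutte S ⟨ ⊤ , r , M₁₂ ⟩ (negU S (mulU S a b)) (negU S (mulU S c d)) ∎)

-- Theorem 3.13: multiplicities in R, evaluated in S through a ring homomorphism φ
-- (which turns the pointwise product m₁ m₂ into the product of the images).

open CommutativeRing using (Carrier; rawRing; _≈_; _*_)

theorem3p13 : ∀ {c₁ ℓ₁ c₂ ℓ₂ : Level}
    (R : CommutativeRing c₁ ℓ₁) (S : CommutativeRing c₂ ℓ₂)
    (φ : Carrier R → Carrier S)
    → RingMorphisms.IsRingHomomorphism (rawRing R) (rawRing S) φ
    → (a b c d : Unit S)
    → (n : ℕ) (r : Subset n → ℤ) (m₁ m₂ : Subset n → Carrier R)
    → _≈_ S
        (tutte S ⟨ ⊤ , r , (λ A → φ (_*_ R (m₁ A) (m₂ A))) ⟩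
               (negU S (mulU S a b)) (negU S (mulU S c d)))
        (sumSub S ⊤ (λ A →
          _*_ S (_*_ S (_*_ S (zpow S a (r ⊤ -ℤ r A)) (zpow S d ((+ ∣ A ∣) -ℤ r A)))
            (tutte S (restrict S ⟨ ⊤ , r , (λ B → φ (m₁ B)) ⟩ A) (negU S a) (negU S c)))
            (tutte S (contract S ⟨ ⊤ , r , (λ B → φ (m₂ B)) ⟩ A) (negU S b) (negU S d))))
theorem3p13 R S φ φ-hom a b c d n r m₁ m₂ =
  Convolution.convolution S a b c d r (λ B → φ (m₁ B)) (λ B → φ (m₂ B))
    (λ A → φ (_*_ R (m₁ A) (m₂ A)))
    (λ X → RingMorphisms.IsRingHomomorphism.*-homo φ-hom (m₁ X) (m₂ X))
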